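{- Let $S=\{s_1<\cdots<s_{k_1}\}$ and $T=\{t_1<\cdots<t_{k_2}\}$ be nonempty subsets of $\{1,\ldots,n-1\}$ and let $d=\gcd\{s+t\mid s\in S,\ t\in T\}$. Then there exists a positive integer $m^\star$ such that $P_{m^\star}\subseteq Q_{m^\star}$.
   Context: $\mathcal{I}_n=\{ -n+1,\ldots,n-1\}$ (integers). For a positive integer $i$: $P_i=\{\ell\in\mathcal{I}_n\mid\ell\equiv is_1\pmod d\}$, and $Q_i$ is the set of integers in $\mathcal{I}_n$ of the form $\sum_{j=1}^{k_1}a_js_j-\sum_{j=1}^{k_2}b_jt_j$ with nonnegative integers $a_j,b_j$ satisfying $\sum_ja_j+\sum_jb_j=i$. -}

module Defs where

open import Data.Nat as ℕ using (ℕ; zero; suc)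
open import Data.Nat.GCD using (gcd)
open import Data.Integer as ℤ using (ℤ; +_; -_; _-_)
open import Data.Integer.Divisibility using () renaming (_∣_ to _∣ℤ_)
open import Data.Fin using (Fin)
import Data.Fin as Fin
open import Data.Vec using (Vec; lookup; toList; zipWith; sum)
open import Data.List using (List; concatMap; map; foldr)
open import Data.Product using (Σ; _×_; ∃; ∃-syntax)
open import Relation.Binary.PropositionalEquality using (_≡_)

InRange : ℕ → ∀ {k} → Vec ℕ k → Set
InRange n {k} S = (j : Fin k) → 1 ℕ.≤ lookup S j × lookup S j ℕ.< n

StrictlyIncreasing : ∀ {k} → Vec ℕ k → Set
StrictlyIncreasing {k} S = (i j : Fin k) → i Fin.< j → lookup S i ℕ.< lookup S j

gcdSums : ∀ {k₁ k₂} → Vec ℕ k₁ → Vec ℕ k₂ → ℕ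
gcdSums S T =
  foldr gcd 0 (concatMap (λ s → map (λ t → s ℕ.+ t) (toList T)) (toList S))

In𝓘 : ℕ → ℤ → Set
In𝓘 n ℓ = - (+ n) ℤ.< ℓ × ℓ ℤ.< + n

InP : (n d s₁ i : ℕ) → ℤ → Set
InP n d s₁ i ℓ = In𝓘 n ℓ × ((+ d) ∣ℤ (ℓ - + (i ℕ.* s₁)))

dot : ∀ {k} → Vec ℕ k → Vec ℕ k → ℕ
dot a s = sum (zipWith ℕ._*_ a s)

InQ : (n : ℕ) → ∀ {k₁ k₂} → Vec ℕ k₁ → Vec ℕ k₂ → ℕ → ℤ → Set
InQ n {k₁} {k₂} S T i ℓ =
  In𝓘 n ℓ ×
  ∃[ a ] ∃[ b ] (sum {n = k₁} a ℕ.+ sum {n = k₂} b ≡ i ×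
                 ℓ ≡ + dot a S - + dot b T)

-- Write x = s₁, y = t₁ and v = x + y. Translating every generator by -x, ℓ ∈ Q_m says
-- that ℓ - m x is a sum of exactly m shifted generators s_i - x and -(t_j + x); as the
-- shifted s₁ is 0, "at most m" suffices. Sums of shifted generators form a submonoid of ℤ
-- containing -v, and adding nonnegative multiples of v turns it into a subgroup. That
-- subgroup contains every s_i + t_j = (s_i - x) - (-(t_j + x)), hence d and -d, so
-- -d - k v is a sum of c₀ shifted generators for some k and c₀. For ℓ ∈ P_m we have
-- ℓ - m x = -q d with q ≥ 0; writing q = j + Q v with j < v,
--   ℓ - m x = j (-d - k v) + (Q d - j k) (-v),
-- and m = n + v² (k + 1 + c₀) is large enough that Q d ≥ j k and j c₀ + Q d - j k ≤ m.
module Submission where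

open import Data.Fin using (zero; suc)
open import Data.Integer as ℤ using (ℤ; +_; -_; -[1+_]; 0ℤ; _+_; _-_; _*_)
import Data.Integer.Properties as ℤ
open import Data.Integer.Tactic.RingSolver using (solve-∀)
open import Data.List using (_∷_; foldr; concatMap; map)
open import Data.List.Membership.Propositional using (_∈_)
open import Data.List.Relation.Unary.Any using (here; there)
open import Data.List.Relation.Unary.All using (All; []; _∷_)
import Data.List.Relation.Unary.All.Properties as ListAll
open import Data.Nat as ℕ using (ℕ; zero; suc; _≤_; _<_; NonZero)
open import Data.Nat.DivMod using (_%_; _/_; m≡m%n+[m/n]*n; m%n<n)
open import Data.Nat.Divisibility using (_∣_; divides; ∣⇒≤; ∣-trans)
open import Data.Nat.GCD using (gcd; gcd-GCD; gcd[m,n]∣m; gcd[m,n]∣n; module Bézout)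
import Data.Nat.Properties as ℕ
open import Algebra.Properties.CommutativeSemigroup ℕ.+-commutativeSemigroup using (x∙yz≈y∙xz)
open import Data.Nat.Tactic.RingSolver using () renaming (solve-∀ to ℕ-solve-∀)
open import Data.Product using (_×_; _,_; ∃-syntax; proj₁; proj₂)
open import Data.Sum using (_⊎_; inj₁; inj₂)
open import Data.Vec using (Vec; []; _∷_; head; lookup; replicate; updateAt; sum; toList)
import Data.Vec.Relation.Unary.All.Properties as VecAll
open import Function using (_∘_)
open import Relation.Binary.PropositionalEquality
open import Relation.Nullary using (contradiction)

open import Defs

data SumOf (G : ℤ → Set) : ℕ → ℤ → Set where
  []  : SumOf G 0 0ℤ
  _∷_ : ∀ {g c w} → G g → SumOf G c w → SumOf G (suc c) (g + w)

module _ {G : ℤ → Set} where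

  singleton : ∀ {g} → G g → SumOf G 1 g
  singleton {g} Gg = subst (SumOf G 1) (ℤ.+-identityʳ g) (Gg ∷ [])

  SumOf-++ : ∀ {c c′ a b} → SumOf G c a → SumOf G c′ b → SumOf G (c ℕ.+ c′) (a + b)
  SumOf-++ {b = b} [] s = subst (SumOf G _) (sym (ℤ.+-identityˡ b)) s
  SumOf-++ {b = b} (_∷_ {g} {w = w} Gg s) s′ =
    subst (SumOf G _) (sym (ℤ.+-assoc g w b)) (Gg ∷ SumOf-++ s s′)

  SumOf-* : ∀ k {c a} → SumOf G c a → SumOf G (k ℕ.* c) (+ k * a)
  SumOf-* zero    {a = a} s = subst (SumOf G 0) (sym (ℤ.*-zeroˡ a)) []
  SumOf-* (suc k) {a = a} s = subst (SumOf G _) (sym (ℤ.suc-* (+ k) a)) (SumOf-++ s (SumOf-* k s))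

  SumOf-pad : G 0ℤ → ∀ {c m a} → c ≤ m → SumOf G c a → SumOf G m a
  SumOf-pad G0 {c} {m} {a} c≤m s = subst (λ l → SumOf G l a) (ℕ.m∸n+n≡m c≤m) (zeros (m ℕ.∸ c))
    where
    zeros : ∀ l → SumOf G (l ℕ.+ c) a
    zeros zero    = s
    zeros (suc l) = subst (SumOf G _) (ℤ.+-identityˡ a) (G0 ∷ zeros l)

  SumOf-translate : ∀ t {c w} → SumOf (λ g → G (g + t)) c w → SumOf G c (w + + c * t)
  SumOf-translate t [] = subst (SumOf G 0) (sym (ℤ.*-zeroˡ t)) []
  SumOf-translate t (_∷_ {g} {c} {w} Gg s) =
    subst (SumOf G _) (regroup g w (+ c) t) (Gg ∷ SumOf-translate t s)
    where
    regroup : ∀ g w c t → (g + t) + (w + c * t) ≡ (g + w) + (+ 1 + c) * t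
    regroup = solve-∀

record IsSubmonoid (P : ℤ → Set) : Set where
  field
    0∈       : P 0ℤ
    +-closed : ∀ {a b} → P a → P b → P (a + b)

  *-closed : ∀ k {a} → P a → P (+ k * a)
  *-closed zero    {a} _  = subst P (sym (ℤ.*-zeroˡ a)) 0∈
  *-closed (suc k) {a} Pa = subst P (sym (ℤ.suc-* (+ k) a)) (+-closed Pa (*-closed k Pa))

Sums : (ℤ → Set) → ℤ → Set
Sums G w = ∃[ c ] SumOf G c w

Sums-isSubmonoid : ∀ {G} → IsSubmonoid (Sums G)
Sums-isSubmonoid = record
  { 0∈       = 0 , []
  ; +-closed = λ (c , s) (c′ , s′) → c ℕ.+ c′ , SumOf-++ s s′
  }

bézout-combination : ∀ {g} m n x y → g ℕ.+ y ℕ.* n ≡ x ℕ.* m → + x * + m - + y * + n ≡ + g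
bézout-combination {g} m n x y eq = begin
  + x * + m - + y * + n             ≡⟨ cong₂ _-_ (ℤ.pos-* x m) (ℤ.pos-* y n) ⟨
  + (x ℕ.* m) - + (y ℕ.* n)         ≡⟨ cong (λ z → + z - + (y ℕ.* n)) eq ⟨
  + (g ℕ.+ y ℕ.* n) - + (y ℕ.* n)   ≡⟨ cong (_- + (y ℕ.* n)) (ℤ.pos-+ g (y ℕ.* n)) ⟩
  + g + + (y ℕ.* n) - + (y ℕ.* n)   ≡⟨ cancel (+ g) (+ (y ℕ.* n)) ⟩
  + g                               ∎
  where
  open ≡-Reasoning
  cancel : ∀ a b → a + b - b ≡ a
  cancel = solve-∀

record IsSubgroup (P : ℤ → Set) : Set where
  field
    isSubmonoid : IsSubmonoid P
    neg-closed  : ∀ {a} → P a → P (- a)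

  open IsSubmonoid isSubmonoid public

  -‿closed : ∀ {a b} → P a → P b → P (a - b)
  -‿closed Pa Pb = +-closed Pa (neg-closed Pb)

  gcd-closed : ∀ {a b} → P (+ a) → P (+ b) → P (+ gcd a b)
  gcd-closed {a} {b} Pa Pb with Bézout.identity (gcd-GCD a b)
  ... | Bézout.+- x y eq = subst P (bézout-combination a b x y eq) (-‿closed (*-closed x Pa) (*-closed y Pb))
  ... | Bézout.-+ x y eq = subst P (bézout-combination b a y x eq) (-‿closed (*-closed y Pb) (*-closed x Pa))

  foldr-gcd-closed : ∀ {L} → All (P ∘ +_) L → P (+ foldr gcd 0 L)
  foldr-gcd-closed []        = 0∈
  foldr-gcd-closed (Pa ∷ PL) = gcd-closed Pa (foldr-gcd-closed PL)

_+ℕ*_ : (ℤ → Set) → ℕ → ℤ → Set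
(P +ℕ* v) w = ∃[ k ] P (w - + k * + v)

module _ {P : ℤ → Set} (P-submonoid : IsSubmonoid P) (v : ℕ) (P-v : P (- + suc v)) where
  open IsSubmonoid P-submonoid

  private
    V : ℤ
    V = + suc v

  ⊆-+ℕ* : ∀ {a} → P a → (P +ℕ* suc v) a
  ⊆-+ℕ* {a} Pa = 0 , subst P (sym (ℤ.+-identityʳ a)) Pa

  minus-multiple-closed : ∀ k {a} → P a → P (a - + k * V)
  minus-multiple-closed k {a} Pa = subst P (eq a (+ k) V) (+-closed Pa (*-closed k P-v))
    where
    eq : ∀ a k V → a + k * - V ≡ a - k * V
    eq = solve-∀

  -- For a = + n, -a = n (-V) + v a; for negative a, v a = -a - |a| V.
  neg-⊆-+ℕ* : ∀ {a} → P a → (P +ℕ* suc v) (- a)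
  neg-⊆-+ℕ* {+ n} Pa = 0 , subst P (eq (+ n) (+ v)) (+-closed (*-closed n P-v) (*-closed v Pa))
    where
    eq : ∀ n v → n * - (+ 1 + v) + v * n ≡ - n - + 0 * (+ 1 + v)
    eq = solve-∀
  neg-⊆-+ℕ* { -[1+ n ]} Pa = suc n , subst P (eq (+ suc n) (+ v)) (*-closed v Pa)
    where
    eq : ∀ n v → v * - n ≡ n - n * (+ 1 + v)
    eq = solve-∀

  +ℕ*-isSubgroup : IsSubgroup (P +ℕ* suc v)
  +ℕ*-isSubgroup = record
    { isSubmonoid = record
      { 0∈       = ⊆-+ℕ* 0∈
      ; +-closed = λ { {a} {b} (k , Pa) (l , Pb) → k ℕ.+ l , subst P (regroup a b k l) (+-closed Pa Pb) }
      }
    ; neg-closed = λ { {a} (k , Pa) → negate a k (neg-⊆-+ℕ* Pa) }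
    }
    where
    regroup : ∀ a b k l → (a - + k * V) + (b - + l * V) ≡ (a + b) - + (k ℕ.+ l) * V
    regroup a b k l = trans (rearrange a b (+ k) (+ l) V) (cong (λ z → (a + b) - z * V) (sym (ℤ.pos-+ k l)))
      where
      rearrange : ∀ a b k l V → (a - k * V) + (b - l * V) ≡ (a + b) - (k + l) * V
      rearrange = solve-∀

    negate : ∀ a k → (P +ℕ* suc v) (- (a - + k * V)) → (P +ℕ* suc v) (- a)
    negate a k (l , Pb) = l , subst P (eq a (+ k) (+ l) V) (minus-multiple-closed k Pb)
      where
      eq : ∀ a k l V → (- (a - k * V) - l * V) - k * V ≡ - a - l * V
      eq = solve-∀

module _ {G : ℤ → Set} {v d k c₀ : ℕ}
         (−v : SumOf G 1 (- + v)) (−d : SumOf G c₀ (- + d - + k * + v)) where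

  SumOf-neg-combination : ∀ j Q → j ℕ.* k ≤ Q ℕ.* d →
    SumOf G (j ℕ.* c₀ ℕ.+ (Q ℕ.* d ℕ.∸ j ℕ.* k)) (- + (j ℕ.* d ℕ.+ Q ℕ.* d ℕ.* v))
  SumOf-neg-combination j Q jk≤Qd =
    subst₂ (SumOf G) (cong (j ℕ.* c₀ ℕ.+_) (ℕ.*-identityʳ r)) value (SumOf-++ (SumOf-* j −d) (SumOf-* r −v))
    where
    open ≡-Reasoning
    r : ℕ
    r = Q ℕ.* d ℕ.∸ j ℕ.* k
    r+jk≡Qd : + r + + j * + k ≡ + (Q ℕ.* d)
    r+jk≡Qd = begin
      + r + + j * + k     ≡⟨ cong (_+_ (+ r)) (ℤ.pos-* j k) ⟨
      + r + + (j ℕ.* k)   ≡⟨ ℤ.pos-+ r (j ℕ.* k) ⟨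
      + (r ℕ.+ j ℕ.* k)   ≡⟨ cong +_ (ℕ.m∸n+n≡m jk≤Qd) ⟩
      + (Q ℕ.* d)         ∎
    expand : ∀ j d k v r → j * (- d - k * v) + r * - v ≡ - (j * d + (r + j * k) * v)
    expand = solve-∀
    value : + j * (- + d - + k * + v) + + r * - + v ≡ - + (j ℕ.* d ℕ.+ Q ℕ.* d ℕ.* v)
    value = begin
      + j * (- + d - + k * + v) + + r * - + v    ≡⟨ expand (+ j) (+ d) (+ k) (+ v) (+ r) ⟩
      - (+ j * + d + (+ r + + j * + k) * + v)    ≡⟨ cong (λ z → - (+ j * + d + z * + v)) r+jk≡Qd ⟩
      - (+ j * + d + + (Q ℕ.* d) * + v)          ≡⟨ cong -_ (cong₂ _+_ (ℤ.pos-* j d) (ℤ.pos-* (Q ℕ.* d) v)) ⟨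
      - (+ (j ℕ.* d) + + (Q ℕ.* d ℕ.* v))        ≡⟨ cong -_ (ℤ.pos-+ (j ℕ.* d) (Q ℕ.* d ℕ.* v)) ⟨
      - + (j ℕ.* d ℕ.+ Q ℕ.* d ℕ.* v)            ∎

remainder-bound : ∀ {v d k j Q} .{{_ : NonZero v}} → j < v → d ≤ v →
  v ℕ.* v ℕ.* suc k < j ℕ.* d ℕ.+ Q ℕ.* d ℕ.* v → j ℕ.* k ≤ Q ℕ.* d
remainder-bound {v} {d} {k} {j} {Q} j<v d≤v vvk<qd =
  ℕ.≤-trans (ℕ.*-monoˡ-≤ k (ℕ.<⇒≤ j<v)) (ℕ.<⇒≤ vk<Qd)
  where
  open ℕ.≤-Reasoning
  expand : ∀ v k → v ℕ.* v ℕ.+ v ℕ.* k ℕ.* v ≡ v ℕ.* v ℕ.* suc k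
  expand = ℕ-solve-∀
  jd<vv : j ℕ.* d < v ℕ.* v
  jd<vv = ℕ.≤-<-trans (ℕ.*-monoʳ-≤ j d≤v) (ℕ.*-monoˡ-< v j<v)
  vk<Qd : v ℕ.* k < Q ℕ.* d
  vk<Qd = ℕ.*-cancelʳ-< v (v ℕ.* k) (Q ℕ.* d) (ℕ.+-cancelˡ-< (v ℕ.* v) _ _ (begin-strict
    v ℕ.* v ℕ.+ v ℕ.* k ℕ.* v    ≡⟨ expand v k ⟩
    v ℕ.* v ℕ.* suc k            <⟨ vvk<qd ⟩
    j ℕ.* d ℕ.+ Q ℕ.* d ℕ.* v    <⟨ ℕ.+-monoˡ-< (Q ℕ.* d ℕ.* v) jd<vv ⟩
    v ℕ.* v ℕ.+ Q ℕ.* d ℕ.* v    ∎))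

length-bound : ∀ {x y d k c₀ j Q m n} .{{_ : NonZero y}} → j ≤ x ℕ.+ y →
  j ℕ.* d ℕ.+ Q ℕ.* d ℕ.* (x ℕ.+ y) < m ℕ.* x ℕ.+ n → n ℕ.+ (x ℕ.+ y) ℕ.* c₀ ℕ.* (x ℕ.+ y) ≤ m →
  j ℕ.* c₀ ℕ.+ (Q ℕ.* d ℕ.∸ j ℕ.* k) ≤ m
length-bound {x} {y} {d} {k} {c₀} {j} {Q} {m} {n} j≤v qd<mx+n n+vcv≤m = begin
  j ℕ.* c₀ ℕ.+ (Q ℕ.* d ℕ.∸ j ℕ.* k)  ≤⟨ ℕ.+-mono-≤ (ℕ.*-monoˡ-≤ c₀ j≤v) (ℕ.m∸n≤m (Q ℕ.* d) (j ℕ.* k)) ⟩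
  v ℕ.* c₀ ℕ.+ Q ℕ.* d                ≡⟨ ℕ.+-comm (v ℕ.* c₀) (Q ℕ.* d) ⟩
  Q ℕ.* d ℕ.+ v ℕ.* c₀                ≤⟨ ℕ.<⇒≤ (ℕ.*-cancelʳ-< v _ _ [Qd+vc]v<mv) ⟩
  m                                   ∎
  where
  open ℕ.≤-Reasoning
  v : ℕ
  v = x ℕ.+ y
  distrib : ∀ Q d v c → (Q ℕ.* d ℕ.+ v ℕ.* c) ℕ.* v ≡ Q ℕ.* d ℕ.* v ℕ.+ v ℕ.* c ℕ.* v
  distrib = ℕ-solve-∀
  [Qd+vc]v<mv : (Q ℕ.* d ℕ.+ v ℕ.* c₀) ℕ.* v < m ℕ.* v
  [Qd+vc]v<mv = begin-strict
    (Q ℕ.* d ℕ.+ v ℕ.* c₀) ℕ.* v                   ≡⟨ distrib Q d v c₀ ⟩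
    Q ℕ.* d ℕ.* v ℕ.+ v ℕ.* c₀ ℕ.* v               ≤⟨ ℕ.+-monoˡ-≤ _ (ℕ.m≤n+m _ (j ℕ.* d)) ⟩
    j ℕ.* d ℕ.+ Q ℕ.* d ℕ.* v ℕ.+ v ℕ.* c₀ ℕ.* v   <⟨ ℕ.+-monoˡ-< _ qd<mx+n ⟩
    m ℕ.* x ℕ.+ n ℕ.+ v ℕ.* c₀ ℕ.* v               ≡⟨ ℕ.+-assoc (m ℕ.* x) n _ ⟩
    m ℕ.* x ℕ.+ (n ℕ.+ v ℕ.* c₀ ℕ.* v)             ≤⟨ ℕ.+-monoʳ-≤ (m ℕ.* x) (ℕ.≤-trans n+vcv≤m (ℕ.m≤m*n m y)) ⟩
    m ℕ.* x ℕ.+ m ℕ.* y                            ≡⟨ ℕ.*-distribˡ-+ m x y ⟨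
    m ℕ.* v                                        ∎

i<0⇒i≡-∣i∣ : ∀ {i} → i ℤ.< 0ℤ → i ≡ - + ℤ.∣ i ∣
i<0⇒i≡-∣i∣ {+ _}      (ℤ.+<+ ())
i<0⇒i≡-∣i∣ { -[1+ _ ]} _ = refl

<⇒≡-∣-∣ : ∀ {ℓ m} → ℓ ℤ.< + m → ℓ ≡ + m - + ℤ.∣ ℓ - + m ∣
<⇒≡-∣-∣ {ℓ} {m} ℓ<m = trans (split ℓ (+ m)) (cong (_+_ (+ m)) (i<0⇒i≡-∣i∣ ℓ-m<0))
  where
  split : ∀ ℓ m → ℓ ≡ m + (ℓ - m)
  split = solve-∀
  ℓ-m<0 : ℓ - + m ℤ.< 0ℤ
  ℓ-m<0 = subst (ℓ - + m ℤ.<_) (ℤ.+-inverseʳ (+ m)) (ℤ.+-monoˡ-< (- + m) ℓ<m)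

-n<m-k⇒k<m+n : ∀ {m n k} → - + n ℤ.< + m - + k → k < m ℕ.+ n
-n<m-k⇒k<m+n {m} {n} {k} h =
  ℤ.drop‿+<+ (subst₂ ℤ._<_ (cancel₁ (+ n) (+ k)) (trans (cancel₂ (+ m) (+ n) (+ k)) (sym (ℤ.pos-+ m n)))
                          (ℤ.+-monoˡ-< (+ k + + n) h))
  where
  cancel₁ : ∀ n k → - n + (k + n) ≡ k
  cancel₁ = solve-∀
  cancel₂ : ∀ m n k → (m - k) + (k + n) ≡ m + n
  cancel₂ = solve-∀

m-k<n⇒m<k+n : ∀ {m n k} → + m - + k ℤ.< + n → m < k ℕ.+ n
m-k<n⇒m<k+n {m} {n} {k} h =
  ℤ.drop‿+<+ (subst₂ ℤ._<_ (cancel (+ m) (+ k)) (sym (ℤ.pos-+ k n)) (ℤ.+-monoʳ-< (+ k) h))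
  where
  cancel : ∀ m k → k + (m - k) ≡ m
  cancel = solve-∀

sum-replicate-0 : ∀ k → sum (replicate k 0) ≡ 0
sum-replicate-0 zero    = refl
sum-replicate-0 (suc k) = sum-replicate-0 k

dot-replicate-0 : ∀ {k} (S : Vec ℕ k) → dot (replicate k 0) S ≡ 0
dot-replicate-0 []      = refl
dot-replicate-0 (_ ∷ S) = dot-replicate-0 S

sum-updateAt-suc : ∀ {k} (a : Vec ℕ k) i → sum (updateAt a i suc) ≡ suc (sum a)
sum-updateAt-suc (x ∷ a) zero    = refl
sum-updateAt-suc (x ∷ a) (suc i) = trans (cong (x ℕ.+_) (sum-updateAt-suc a i)) (ℕ.+-suc x (sum a))

dot-updateAt-suc : ∀ {k} (a S : Vec ℕ k) i → dot (updateAt a i suc) S ≡ lookup S i ℕ.+ dot a S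
dot-updateAt-suc (x ∷ a) (s ∷ S) zero    = ℕ.+-assoc s (x ℕ.* s) (dot a S)
dot-updateAt-suc (x ∷ a) (s ∷ S) (suc i) =
  trans (cong (x ℕ.* s ℕ.+_) (dot-updateAt-suc a S i)) (x∙yz≈y∙xz (x ℕ.* s) (lookup S i) (dot a S))

foldr-gcd-∣ : ∀ {a L} → a ∈ L → foldr gcd 0 L ∣ a
foldr-gcd-∣ {L = b ∷ L} (here refl)  = gcd[m,n]∣m b (foldr gcd 0 L)
foldr-gcd-∣ {L = b ∷ L} (there a∈L) = ∣-trans (gcd[m,n]∣n b (foldr gcd 0 L)) (foldr-gcd-∣ a∈L)

All-pairwise-sums : ∀ {P : ℕ → Set} {k₁ k₂} (S : Vec ℕ k₁) (T : Vec ℕ k₂) →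
  (∀ i j → P (lookup S i ℕ.+ lookup T j)) →
  All P (concatMap (λ s → map (λ t → s ℕ.+ t) (toList T)) (toList S))
All-pairwise-sums S T P-sums =
  ListAll.concat⁺ (ListAll.map⁺ (VecAll.toList⁺ (VecAll.lookup⁻ {xs = S} λ i →
    ListAll.map⁺ {f = lookup S i ℕ.+_} (VecAll.toList⁺ (VecAll.lookup⁻ {xs = T} (P-sums i))))))

module _ {k₁ k₂} (S : Vec ℕ k₁) (T : Vec ℕ k₂) where

  Generator : ℤ → Set
  Generator g = (∃[ i ] g ≡ + lookup S i) ⊎ (∃[ j ] g ≡ - + lookup T j)

  SumOf-Generator⇒coefficients : ∀ {c ℓ} → SumOf Generator c ℓ →
    ∃[ a ] ∃[ b ] (sum {n = k₁} a ℕ.+ sum {n = k₂} b ≡ c × ℓ ≡ + dot a S - + dot b T)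
  SumOf-Generator⇒coefficients [] =
    replicate k₁ 0 , replicate k₂ 0 ,
    cong₂ ℕ._+_ (sum-replicate-0 k₁) (sum-replicate-0 k₂) ,
    cong₂ (λ p q → + p - + q) (sym (dot-replicate-0 S)) (sym (dot-replicate-0 T))
  SumOf-Generator⇒coefficients (inj₁ (i , refl) ∷ s)
    with a , b , #ab , refl ← SumOf-Generator⇒coefficients s =
    updateAt a i suc , b ,
    trans (cong (ℕ._+ sum b) (sum-updateAt-suc a i)) (cong suc #ab) ,
    (begin
      + lookup S i + (+ dot a S - + dot b T)   ≡⟨ rearrange (+ lookup S i) (+ dot a S) (+ dot b T) ⟩
      (+ lookup S i + + dot a S) - + dot b T   ≡⟨ cong (_- + dot b T) (ℤ.pos-+ (lookup S i) (dot a S)) ⟨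
      + (lookup S i ℕ.+ dot a S) - + dot b T   ≡⟨ cong (λ p → + p - + dot b T) (dot-updateAt-suc a S i) ⟨
      + dot (updateAt a i suc) S - + dot b T   ∎)
    where
    open ≡-Reasoning
    rearrange : ∀ s A B → s + (A - B) ≡ (s + A) - B
    rearrange = solve-∀
  SumOf-Generator⇒coefficients (inj₂ (j , refl) ∷ s)
    with a , b , #ab , refl ← SumOf-Generator⇒coefficients s =
    a , updateAt b j suc ,
    trans (cong (sum a ℕ.+_) (sum-updateAt-suc b j)) (trans (ℕ.+-suc (sum a) (sum b)) (cong suc #ab)) ,
    (begin
      - + lookup T j + (+ dot a S - + dot b T)  ≡⟨ rearrange (+ lookup T j) (+ dot a S) (+ dot b T) ⟩
      + dot a S - (+ lookup T j + + dot b T)    ≡⟨ cong (λ p → + dot a S - p) (ℤ.pos-+ (lookup T j) (dot b T)) ⟨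
      + dot a S - + (lookup T j ℕ.+ dot b T)    ≡⟨ cong (λ p → + dot a S - + p) (dot-updateAt-suc b T j) ⟨
      + dot a S - + dot (updateAt b j suc) T    ∎)
    where
    open ≡-Reasoning
    rearrange : ∀ t A B → - t + (A - B) ≡ A - (t + B)
    rearrange = solve-∀

module _ {k₁ k₂} (x′ : ℕ) (xs : Vec ℕ k₁) (y′ : ℕ) (ys : Vec ℕ k₂) where
  private
    S : Vec ℕ (suc k₁)
    S = suc x′ ∷ xs
    T : Vec ℕ (suc k₂)
    T = suc y′ ∷ ys
    x y v d : ℕ
    x = suc x′
    y = suc y′
    v = x ℕ.+ y
    d = gcdSums S T

  Shifted : ℤ → Set
  Shifted g = Generator S T (g + + x)

  S-shifted : ∀ i → SumOf Shifted 1 (+ lookup S i - + x)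
  S-shifted i = singleton (inj₁ (i , cancel (+ lookup S i) (+ x)))
    where
    cancel : ∀ s x → s - x + x ≡ s
    cancel = solve-∀

  T-shifted : ∀ j → SumOf Shifted 1 (- + (x ℕ.+ lookup T j))
  T-shifted j = singleton (inj₂ (j , trans (cong (λ z → - z + + x) (ℤ.pos-+ x (lookup T j)))
                                           (cancel (+ x) (+ lookup T j))))
    where
    cancel : ∀ x t → - (x + t) + x ≡ - t
    cancel = solve-∀

  Span : ℤ → Set
  Span = Sums Shifted +ℕ* v

  private
    −v∈Sums : Sums Shifted (- + v)
    −v∈Sums = 1 , T-shifted zero

    ⊆Span : ∀ {a} → SumOf Shifted 1 a → Span a
    ⊆Span s = ⊆-+ℕ* Sums-isSubmonoid (x′ ℕ.+ y) −v∈Sums (1 , s)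

  Span-isSubgroup : IsSubgroup Span
  Span-isSubgroup = +ℕ*-isSubgroup Sums-isSubmonoid (x′ ℕ.+ y) −v∈Sums

  open IsSubgroup Span-isSubgroup

  sum-∈Span : ∀ i j → Span (+ (lookup S i ℕ.+ lookup T j))
  sum-∈Span i j = subst Span (eq (lookup S i) (lookup T j))
    (-‿closed {+ lookup S i - + x} { - + (x ℕ.+ lookup T j)} (⊆Span (S-shifted i)) (⊆Span (T-shifted j)))
    where
    cancel : ∀ s x t → (s - x) - - (x + t) ≡ s + t
    cancel = solve-∀
    eq : ∀ s t → (+ s - + x) - - + (x ℕ.+ t) ≡ + (s ℕ.+ t)
    eq s t = begin
      (+ s - + x) - - + (x ℕ.+ t)   ≡⟨ cong (λ z → (+ s - + x) - - z) (ℤ.pos-+ x t) ⟩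
      (+ s - + x) - - (+ x + + t)   ≡⟨ cancel (+ s) (+ x) (+ t) ⟩
      + s + + t                     ≡⟨ ℤ.pos-+ s t ⟨
      + (s ℕ.+ t)                   ∎
      where open ≡-Reasoning

  gcd-∈Span : Span (+ d)
  gcd-∈Span = foldr-gcd-closed (All-pairwise-sums S T sum-∈Span)

  -- The explicit list here and `+ d` in P⊆Q stop Agda from normalising gcdSums during inference.
  d∣v : d ∣ v
  d∣v = foldr-gcd-∣ {L = concatMap (λ s → map (λ t → s ℕ.+ t) (toList T)) (toList S)} (here refl)

  module _ (n k c₀ : ℕ) (−d : SumOf Shifted c₀ (- + d - + k * + v)) where

    m : ℕ
    m = n ℕ.+ v ℕ.* v ℕ.* (suc k ℕ.+ c₀)

    n≤m : n ≤ m
    n≤m = ℕ.m≤m+n n (v ℕ.* v ℕ.* (suc k ℕ.+ c₀))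

    private
      vvk+n≤m : v ℕ.* v ℕ.* suc k ℕ.+ n ≤ m
      vvk+n≤m = ℕ.≤-trans (ℕ.m≤m+n _ (v ℕ.* v ℕ.* c₀)) (ℕ.≤-reflexive (regroup n (v ℕ.* v) (suc k) c₀))
        where
        regroup : ∀ n w k c → w ℕ.* k ℕ.+ n ℕ.+ w ℕ.* c ≡ n ℕ.+ w ℕ.* (k ℕ.+ c)
        regroup = ℕ-solve-∀

      n+vcv≤m : n ℕ.+ v ℕ.* c₀ ℕ.* v ≤ m
      n+vcv≤m = ℕ.≤-trans (ℕ.m≤m+n _ (v ℕ.* v ℕ.* suc k)) (ℕ.≤-reflexive (regroup n v (suc k) c₀))
        where
        regroup : ∀ n v k c → n ℕ.+ v ℕ.* c ℕ.* v ℕ.+ v ℕ.* v ℕ.* k ≡ n ℕ.+ v ℕ.* v ℕ.* (k ℕ.+ c)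
        regroup = ℕ-solve-∀

    InP⇒InQ : ∀ ℓ → InP n d x m ℓ → InQ n S T m ℓ
    InP⇒InQ ℓ (ℓ∈𝓘@(-n<ℓ , ℓ<n) , divides q ∣ℓ-M∣≡qd) =
      ℓ∈𝓘 , SumOf-Generator⇒coefficients S T
              (subst (SumOf (Generator S T) m) value (SumOf-translate (+ x) representation))
      where
      M j Q : ℕ
      M = m ℕ.* x
      j = q % v
      Q = q / v
      split : ∀ j Q v d → (j ℕ.+ Q ℕ.* v) ℕ.* d ≡ j ℕ.* d ℕ.+ Q ℕ.* d ℕ.* v
      split = ℕ-solve-∀
      qd≡ : q ℕ.* d ≡ j ℕ.* d ℕ.+ Q ℕ.* d ℕ.* v
      qd≡ = trans (cong (ℕ._* d) (m≡m%n+[m/n]*n q v)) (split j Q v d)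
      ℓ≡M-qd : ℓ ≡ + M - + (q ℕ.* d)
      ℓ≡M-qd = trans (<⇒≡-∣-∣ (ℤ.<-≤-trans ℓ<n (ℤ.+≤+ (ℕ.≤-trans n≤m (ℕ.m≤m*n m x)))))
                     (cong (λ z → + M - + z) ∣ℓ-M∣≡qd)
      qd<M+n : j ℕ.* d ℕ.+ Q ℕ.* d ℕ.* v < M ℕ.+ n
      qd<M+n = subst (_< M ℕ.+ n) qd≡ (-n<m-k⇒k<m+n (subst (- + n ℤ.<_) ℓ≡M-qd -n<ℓ))
      M<qd+n : M < j ℕ.* d ℕ.+ Q ℕ.* d ℕ.* v ℕ.+ n
      M<qd+n = subst (λ z → M < z ℕ.+ n) qd≡ (m-k<n⇒m<k+n (subst (ℤ._< + n) ℓ≡M-qd ℓ<n))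
      jk≤Qd : j ℕ.* k ≤ Q ℕ.* d
      jk≤Qd = remainder-bound {k = k} {j} {Q} (m%n<n q v) (∣⇒≤ d∣v)
        (ℕ.+-cancelʳ-< n _ _ (ℕ.≤-<-trans (ℕ.≤-trans vvk+n≤m (ℕ.m≤m*n m x)) M<qd+n))
      representation : SumOf Shifted m (- + (j ℕ.* d ℕ.+ Q ℕ.* d ℕ.* v))
      representation = SumOf-pad (inj₁ (zero , refl))
        (length-bound {k = k} {c₀} {j} {Q} (ℕ.<⇒≤ (m%n<n q v)) qd<M+n n+vcv≤m)
        (SumOf-neg-combination (T-shifted zero) −d j Q jk≤Qd)
      value : - + (j ℕ.* d ℕ.+ Q ℕ.* d ℕ.* v) + + m * + x ≡ ℓ
      value = begin
        - + (j ℕ.* d ℕ.+ Q ℕ.* d ℕ.* v) + + m * + x  ≡⟨ cong₂ (λ a b → - + a + b) qd≡ (ℤ.pos-* m x) ⟨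
        - + (q ℕ.* d) + + M                          ≡⟨ ℤ.+-comm (- + (q ℕ.* d)) (+ M) ⟩
        + M - + (q ℕ.* d)                            ≡⟨ ℓ≡M-qd ⟨
        ℓ                                            ∎
        where open ≡-Reasoning

  P⊆Q : ∀ n → x < n → ∃[ m ] (1 ≤ m × ((ℓ : ℤ) → InP n d x m ℓ → InQ n S T m ℓ))
  P⊆Q n x<n = witness (neg-closed {+ d} gcd-∈Span)
    where
    witness : Span (- + d) → ∃[ m ] (1 ≤ m × ((ℓ : ℤ) → InP n d x m ℓ → InQ n S T m ℓ))
    witness (k , c₀ , −d) = m n k c₀ −d , ℕ.≤-trans (ℕ.s≤s ℕ.z≤n) (ℕ.<⇒≤ (ℕ.<-≤-trans x<n (n≤m n k c₀ −d))) , InP⇒InQ n k c₀ −d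

theorem4p3 : (n k₁ k₂ : ℕ) (S : Vec ℕ (suc k₁)) (T : Vec ℕ (suc k₂)) →
    StrictlyIncreasing S → StrictlyIncreasing T →
    InRange n S → InRange n T →
    ∃[ m ] (1 ≤ m ×
      ((ℓ : ℤ) → InP n (gcdSums S T) (head S) m ℓ → InQ n S T m ℓ))
theorem4p3 n k₁ k₂ (zero ∷ _) T _ _ S-range _ = contradiction (proj₁ (S-range zero)) λ ()
theorem4p3 n k₁ k₂ (suc x′ ∷ xs) (zero ∷ _) _ _ _ T-range = contradiction (proj₁ (T-range zero)) λ ()
theorem4p3 n k₁ k₂ (suc x′ ∷ xs) (suc y′ ∷ ys) _ _ S-range _ = P⊆Q x′ xs y′ ys n (proj₂ (S-range zero))
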